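{- For every $n \geq 1$, the poset $(\mathsf{Tr}(n),\preccurlyeq)$ is constructible by interval doubling.
   Context: For $n\ge1$, $\mathsf{Tr}(n)$ is the set of words $u = u_1\cdots u_n$ over $\{0,1,2\}$ with $u_1 \neq 2$ and no indices $i<j$ with $u_i=0$, $u_j=1$, ordered componentwise ($u\preccurlyeq v$ iff $u_i\le v_i$ for all $i$). Let $\mathbf{2}$ be the poset $\{0<1\}$. For a poset $\mathcal{P}$ and an interval $I$ of $\mathcal{P}$, the interval doubling $\mathcal{P}[I]$ is the set $(\mathcal{P}\setminus I) \cup (I \times \mathbf{2})$ with the order: for $x,y \in \mathcal{P}\setminus I$, $x \le y$ iff $x \preccurlyeq_{\mathcal{P}} y$; for $x \in \mathcal{P}\setminus I$ and $(y',b) \in I\times\mathbf{2}$, $x \le (y',b)$ iff $x \preccurlyeq_{\mathcal{P}} y'$; $(x',a) \le y$ with $y\in\mathcal{P}\setminus I$ iff $x' \preccurlyeq_{\mathcal{P}} y$; and $(x',a)\le(y',b)$ iff $x'\preccurlyeq_{\mathcal{P}} y'$ and $a \le b$. A lattice is constructible by interval doubling if it is isomorphic as a poset to a poset obtained from the one-element lattice by a finite sequence of interval doublings. -}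

module Defs where

open import Data.Bool using (Bool; true; false; _∧_; _∨_; not; if_then_else_; T)
open import Data.Unit using (⊤; tt)
open import Data.Nat using (ℕ; suc; _<ᵇ_; _≤ᵇ_)
open import Data.Fin using (Fin; toℕ; zero; suc)
open import Data.Vec using (Vec; []; _∷_; lookup)
open import Data.List using (List; []; _∷_)
open import Data.List.Base using (allFin)
open import Data.Product using (Σ; _,_; _×_; proj₁)
open import Function.Bundles using (_↔_; Inverse)
open import Relation.Binary.PropositionalEquality using (_≡_)

-- Boolean-valued so that
-- membership in an interval is decidable and proof-irrelevant.
record BPoset : Set₁ where
  field
    Carrier : Set
    le      : Carrier → Carrier → Bool
open BPoset public

one : BPoset
one = record { Carrier = ⊤ ; le = λ _ _ → true }

-- order on 2 = {0 < 1}, encoded by Bool with false < true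
_≤₂_ : Bool → Bool → Bool
a ≤₂ b = not a ∨ b

inI : (P : BPoset) → Carrier P → Carrier P → Carrier P → Bool
inI P a b x = le P a x ∧ le P x b

-- fibre: elements outside I get one copy (⊤), elements of I get two (Bool)
Fib : Bool → Set
Fib true  = Bool
Fib false = ⊤

cmpFib : (p q : Bool) → Fib p → Fib q → Bool
cmpFib true  true  s t = s ≤₂ t
cmpFib true  false _ _ = true
cmpFib false true  _ _ = true
cmpFib false false _ _ = true

-- interval doubling P[I] for I = [a , b]:
-- carrier (P ∖ I) ∪ (I × 2), realised as Σ x, Fib (x ∈ I)
double : (P : BPoset) → Carrier P → Carrier P → BPoset
double P a b = record
  { Carrier = Σ (Carrier P) (λ x → Fib (inI P a b x))
  ; le      = λ { (x , s) (y , t) →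
                  le P x y ∧ cmpFib (inI P a b x) (inI P a b y) s t }
  }

data Doubled : BPoset → Set₁ where
  base : Doubled one
  step : (P : BPoset) → Doubled P → (a b : Carrier P) →
         T (le P a b) → Doubled (double P a b)

record Iso (P Q : BPoset) : Set where
  field
    bij   : Carrier P ↔ Carrier Q
    order : ∀ x y → le P x y ≡ le Q (Inverse.to bij x) (Inverse.to bij y)

Constructible : BPoset → Set₁
Constructible Q = Σ BPoset (λ P → Doubled P × Iso P Q)

allB : {A : Set} → (A → Bool) → List A → Bool
allB p []       = true
allB p (x ∷ xs) = p x ∧ allB p xs

_==_ : {k : ℕ} → Fin k → Fin k → Bool
i == j = toℕ i Data.Nat.≡ᵇ toℕ j
  where import Data.Nat

two zer on : Fin 3
zer = zero
on  = suc zero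
two = suc (suc zero)

firstNot2 : {n : ℕ} → Vec (Fin 3) n → Bool
firstNot2 []      = true
firstNot2 (x ∷ _) = not (x == two)

no01 : {n : ℕ} → Vec (Fin 3) n → Bool
no01 {n} u = allB (λ i → allB (λ j →
               not ((toℕ i <ᵇ toℕ j) ∧ (lookup u i == zer) ∧ (lookup u j == on)))
               (allFin n)) (allFin n)

isTr : {n : ℕ} → Vec (Fin 3) n → Bool
isTr u = firstNot2 u ∧ no01 u

leqW : {n : ℕ} → Vec (Fin 3) n → Vec (Fin 3) n → Bool
leqW {n} u v = allB (λ i → toℕ (lookup u i) ≤ᵇ toℕ (lookup v i)) (allFin n)

Tr : ℕ → BPoset
Tr n = record
  { Carrier = Σ (Vec (Fin 3) n) (λ u → T (isTr u))
  ; le      = λ u v → leqW (proj₁ u) (proj₁ v)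
  }

module Submission where

-- Idea: a word u·c (u of length n ≥ 1, c a letter) lies in Tr(n+1) iff
-- u ∈ Tr(n) and either c ≠ 1 or u contains no 0; the order is
-- componentwise.  Hence Tr(n+1) ≅ Ext(Tr(n), U), where U = {u : no 0 in u}
-- and Ext(P, U) consists of the pairs (x, c) with c ∈ {0, 2}, or c = 1 and
-- x ∈ U, ordered as a product.  For an up-set U = [a, ⊤] of a bounded poset
-- P, Ext(P, U) arises from P by two interval doublings: doubling
-- [⊥, ⊤] = P gives P × 2 (letters 0 < 2), and doubling [(a,0), (⊤,0)]
-- inserts the letter 1 above U.  In Tr(n): ⊥ = 0…0, ⊤ = 12…2, a = 1…1.

open import Defs
open import Data.Bool using (Bool; true; false; _∧_; _∨_; not; T)
open import Data.Bool.Properties using (T-irrelevant; T-≡; T-∧; ∧-assoc; ∧-identityʳ; ∧-zeroʳ; ∨-zeroʳ)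
open import Data.Unit using (tt)
open import Data.Empty using (⊥-elim)
open import Data.Product using (Σ; _,_; proj₁; proj₂; _×_)
open import Data.Nat using (ℕ; zero; suc; _≤_; _≤ᵇ_; _<ᵇ_)
open import Data.Fin using (Fin; toℕ; zero; suc)
open import Data.Vec using (Vec; []; _∷_; lookup; _∷ʳ_; replicate; init; last; initLast)
open import Data.Vec.Properties using (init-∷ʳ; last-∷ʳ)
open import Data.List using (tabulate)
open import Function using (_∘_; id)
open import Function.Bundles using (Inverse; mk↔ₛ′; Equivalence)
open import Relation.Binary.PropositionalEquality
  using (_≡_; refl; sym; trans; cong; cong₂; subst; subst-subst; module ≡-Reasoning)

fromTrue : {b : Bool} → b ≡ true → T b
fromTrue = Equivalence.from T-≡

isoTo : {P Q : BPoset} → Iso P Q → Carrier P → Carrier Q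
isoTo f = Inverse.to (Iso.bij f)

isoFrom : {P Q : BPoset} → Iso P Q → Carrier Q → Carrier P
isoFrom f = Inverse.from (Iso.bij f)

Iso-trans : {P Q R : BPoset} → Iso P Q → Iso Q R → Iso P R
Iso-trans f g = record
  { bij   = mk↔ₛ′ (isoTo g ∘ isoTo f) (isoFrom f ∘ isoFrom g)
      (λ z → trans (cong (isoTo g) (Inverse.strictlyInverseˡ (Iso.bij f) (isoFrom g z)))
                   (Inverse.strictlyInverseˡ (Iso.bij g) z))
      (λ x → trans (cong (isoFrom f) (Inverse.strictlyInverseʳ (Iso.bij g) (isoTo f x)))
                   (Inverse.strictlyInverseʳ (Iso.bij f) x))
  ; order = λ x y → trans (Iso.order f x y) (Iso.order g (isoTo f x) (isoTo f y))
  }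

Constructible-Iso : {P Q : BPoset} → Constructible P → Iso P Q → Constructible Q
Constructible-Iso (R , d , f) g = R , d , Iso-trans f g

-- Doubling of P along an arbitrary Boolean predicate m; the interval
-- doubling  double P a b  is, by definition, doubling along  inI P a b.
doubleAlong : (P : BPoset) → (Carrier P → Bool) → BPoset
doubleAlong P m = record
  { Carrier = Σ (Carrier P) (λ x → Fib (m x))
  ; le      = λ { (x , s) (y , t) → le P x y ∧ cmpFib (m x) (m y) s t }
  }

subst-Fib-loop : {b : Bool} (q : b ≡ b) (t : Fib b) → subst Fib q t ≡ t
subst-Fib-loop refl t = refl

cmpFib-subst : {b₁ b₁′ b₂ b₂′ : Bool} (e₁ : b₁′ ≡ b₁) (e₂ : b₂′ ≡ b₂)
               (s : Fib b₁) (t : Fib b₂) →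
               cmpFib b₁ b₂ s t ≡ cmpFib b₁′ b₂′ (subst Fib (sym e₁) s) (subst Fib (sym e₂) t)
cmpFib-subst refl refl s t = refl

Σ-Fib-≡ : {A : Set} (m : A → Bool) {y′ y : A} (p : y′ ≡ y) (t : Fib (m y)) (q : m y ≡ m y′) →
          _≡_ {A = Σ A (Fib ∘ m)} (y′ , subst Fib q t) (y , t)
Σ-Fib-≡ m refl t q = cong (_ ,_) (subst-Fib-loop q t)

doubleAlong-Iso : {P Q : BPoset} (f : Iso P Q) (m : Carrier P → Bool) (m′ : Carrier Q → Bool) →
                  (∀ x → m′ (isoTo f x) ≡ m x) → Iso (doubleAlong P m) (doubleAlong Q m′)
doubleAlong-Iso {P} {Q} f m m′ e = record
  { bij   = mk↔ₛ′ to′ from′ to∘from from∘to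
  ; order = λ { (x , s) (y , t) →
                cong₂ _∧_ (Iso.order f x y) (cmpFib-subst (e x) (e y) s t) }
  }
  where
  g = isoFrom f
  to∘g : ∀ y → isoTo f (g y) ≡ y
  to∘g = Inverse.strictlyInverseˡ (Iso.bij f)
  g∘to : ∀ x → g (isoTo f x) ≡ x
  g∘to = Inverse.strictlyInverseʳ (Iso.bij f)
  e′ : ∀ y → m′ y ≡ m (g y)
  e′ y = trans (cong m′ (sym (to∘g y))) (e (g y))
  to′ : Carrier (doubleAlong P m) → Carrier (doubleAlong Q m′)
  to′ (x , s) = isoTo f x , subst Fib (sym (e x)) s
  from′ : Carrier (doubleAlong Q m′) → Carrier (doubleAlong P m)
  from′ (y , t) = g y , subst Fib (e′ y) t
  to∘from : ∀ z → to′ (from′ z) ≡ z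
  to∘from (y , t) = trans (cong (isoTo f (g y) ,_) (subst-subst (e′ y)))
                          (Σ-Fib-≡ m′ (to∘g y) t (trans (e′ y) (sym (e (g y)))))
  from∘to : ∀ z → from′ (to′ z) ≡ z
  from∘to (x , s) = trans (cong (g (isoTo f x) ,_) (subst-subst (sym (e x))))
                          (Σ-Fib-≡ m (g∘to x) s (trans (sym (e x)) (e′ (isoTo f x))))

-- Doubling a constructible poset along a predicate that picks out an
-- interval [a, b] (with a ≤ b) yields a constructible poset: transport the
-- interval to the doubling sequence's poset and perform one more step.
Constructible-doubleAlong : {Q : BPoset} → Constructible Q → (a b : Carrier Q) → le Q a b ≡ true →
                            (m : Carrier Q → Bool) → (∀ x → m x ≡ inI Q a b x) →
                            Constructible (doubleAlong Q m)
Constructible-doubleAlong {Q} (P , d , f) a b a≤b m m≡I =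
  double P (g a) (g b) , step P d (g a) (g b) (fromTrue (trans (g-order a b) a≤b)) ,
  doubleAlong-Iso f (inI P (g a) (g b)) m interval
  where
  g = isoFrom f
  g-order : ∀ u v → le P (g u) (g v) ≡ le Q u v
  g-order u v = trans (Iso.order f (g u) (g v))
                      (cong₂ (le Q) (Inverse.strictlyInverseˡ (Iso.bij f) u)
                                    (Inverse.strictlyInverseˡ (Iso.bij f) v))
  g∘to : ∀ x → g (isoTo f x) ≡ x
  g∘to = Inverse.strictlyInverseʳ (Iso.bij f)
  interval : ∀ x → m (isoTo f x) ≡ inI P (g a) (g b) x
  interval x = trans (m≡I (isoTo f x)) (sym (cong₂ _∧_
    (trans (cong (le P (g a)) (sym (g∘to x))) (g-order a (isoTo f x)))
    (trans (cong (λ z → le P z (g b)) (sym (g∘to x))) (g-order (isoTo f x) b))))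

leF : Fin 3 → Fin 3 → Bool
leF c d = toℕ c ≤ᵇ toℕ d

Allowed : Fin 3 → Bool → Set
Allowed c u = T (not (c == on) ∨ u)

Ext : (P : BPoset) → (Carrier P → Bool) → BPoset
Ext P U = record
  { Carrier = Σ (Carrier P) (λ x → Σ (Fin 3) (λ c → Allowed c (U x)))
  ; le      = λ p q → le P (proj₁ p) (proj₁ q) ∧ leF (proj₁ (proj₂ p)) (proj₁ (proj₂ q))
  }

UpClosed : (P : BPoset) → (Carrier P → Bool) → Set
UpClosed P U = ∀ x y → T (le P x y) → T (U x) → T (U y)

-- Doubling all of P (copies 0 < 2), then the 0-copies over U (inserting 1).
twoLetters : BPoset → BPoset
twoLetters P = doubleAlong P (λ _ → true)

threeLetters : (P : BPoset) → (Carrier P → Bool) → BPoset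
threeLetters P U = doubleAlong (twoLetters P) (λ p → not (proj₂ p) ∧ U (proj₁ p))

-- Decoding the doubling bits into a letter: s = true is 2, otherwise the
-- bit t (present only over U) chooses between 0 and 1.
letter : (u s : Bool) → Fib (not s ∧ u) → Σ (Fin 3) (λ c → Allowed c u)
letter u     true  _     = two , tt
letter true  false false = zer , tt
letter true  false true  = on , tt
letter false false _     = zer , tt

unletter : (u : Bool) (c : Fin 3) → Allowed c u → Σ Bool (λ s → Fib (not s ∧ u))
unletter u     (suc (suc zero)) _ = true , tt
unletter true  zero             _ = false , false
unletter false zero             _ = false , tt
unletter true  (suc zero)       _ = false , true
unletter false (suc zero)       ()

letter-unletter : (u : Bool) (c : Fin 3) (p : Allowed c u) →
                  letter u (proj₁ (unletter u c p)) (proj₂ (unletter u c p)) ≡ (c , p)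
letter-unletter u     (suc (suc zero)) _ = refl
letter-unletter true  zero             _ = refl
letter-unletter false zero             _ = refl
letter-unletter true  (suc zero)       _ = refl
letter-unletter false (suc zero)       ()

unletter-letter : (u s : Bool) (t : Fib (not s ∧ u)) →
                  unletter u (proj₁ (letter u s t)) (proj₂ (letter u s t)) ≡ (s , t)
unletter-letter u     true  _     = refl
unletter-letter true  false false = refl
unletter-letter true  false true  = refl
unletter-letter false false _     = refl

letter-order : (l u v s s′ : Bool) (t : Fib (not s ∧ u)) (t′ : Fib (not s′ ∧ v)) →
               (T l → T u → T v) →
               (l ∧ (s ≤₂ s′)) ∧ cmpFib (not s ∧ u) (not s′ ∧ v) t t′ ≡
               l ∧ leF (proj₁ (letter u s t)) (proj₁ (letter v s′ t′))
letter-order false _     _     _     _     _     _     _ = refl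
letter-order true  _     _     true  true  _     _     _ = refl
letter-order true  _     true  true  false _     false _ = refl
letter-order true  _     true  true  false _     true  _ = refl
letter-order true  _     false true  false _     _     _ = refl
letter-order true  true  _     false true  false _     _ = refl
letter-order true  true  _     false true  true  _     _ = refl
letter-order true  false _     false true  _     _     _ = refl
letter-order true  true  true  false false t     t′    _ = lemma t t′
  where
  lemma : (t t′ : Bool) → (t ≤₂ t′) ≡ leF (proj₁ (letter true false t)) (proj₁ (letter true false t′))
  lemma false _     = refl
  lemma true  false = refl
  lemma true  true  = refl
letter-order true  true  false false false false _     _ = refl
letter-order true  true  false false false true  _     U↑ = ⊥-elim (U↑ tt tt)
letter-order true  false true  false false _     false _ = refl
letter-order true  false true  false false _     true  _ = refl
letter-order true  false false false false _     _     _ = refl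

threeLetters-Iso : {P : BPoset} (U : Carrier P → Bool) → UpClosed P U → Iso (threeLetters P U) (Ext P U)
threeLetters-Iso {P} U U↑ = record { bij = mk↔ₛ′ to′ from′ to∘from from∘to ; order = order }
  where
  to′ : Carrier (threeLetters P U) → Carrier (Ext P U)
  to′ ((x , s) , t) = x , letter (U x) s t
  pack : (x : Carrier P) → Σ Bool (λ s → Fib (not s ∧ U x)) → Carrier (threeLetters P U)
  pack x (s , t) = (x , s) , t
  from′ : Carrier (Ext P U) → Carrier (threeLetters P U)
  from′ (x , c , p) = pack x (unletter (U x) c p)
  to∘from : ∀ z → to′ (from′ z) ≡ z
  to∘from (x , c , p) = cong (x ,_) (letter-unletter (U x) c p)
  from∘to : ∀ z → from′ (to′ z) ≡ z
  from∘to ((x , s) , t) = cong (pack x) (unletter-letter (U x) s t)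
  order : ∀ p q → le (threeLetters P U) p q ≡ le (Ext P U) (to′ p) (to′ q)
  order ((x , s) , t) ((y , s′) , t′) = letter-order (le P x y) (U x) (U y) s s′ t t′ (U↑ x y)

Constructible-Ext : {P : BPoset} (U : Carrier P → Bool) (bot top a : Carrier P) →
                    (∀ x → le P bot x ≡ true) → (∀ x → le P x top ≡ true) →
                    (∀ x → U x ≡ le P a x) → UpClosed P U →
                    Constructible P → Constructible (Ext P U)
Constructible-Ext {P} U bot top a isBot isTop U≡[a,⊤] U↑ cP =
  Constructible-Iso threeCon (threeLetters-Iso U U↑)
  where
  twoCon : Constructible (twoLetters P)
  twoCon = Constructible-doubleAlong cP bot top (isBot top) (λ _ → true)
             (λ x → sym (cong₂ _∧_ (isBot x) (isTop x)))
  -- not s ∧ u, written as the membership test of [(a , 0), (⊤ , 0)]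
  lowerCopy : (u s : Bool) → not s ∧ u ≡ (u ∧ (false ≤₂ s)) ∧ (true ∧ (s ≤₂ false))
  lowerCopy u     true  = sym (∧-zeroʳ (u ∧ true))
  lowerCopy u     false = sym (trans (∧-identityʳ (u ∧ true)) (∧-identityʳ u))
  upper : ∀ p → not (proj₂ p) ∧ U (proj₁ p) ≡ inI (twoLetters P) (a , false) (top , false) p
  upper (x , s) = trans (lowerCopy (U x) s)
    (cong₂ (λ l r → (l ∧ (false ≤₂ s)) ∧ (r ∧ (s ≤₂ false))) (U≡[a,⊤] x) (sym (isTop x)))
  threeCon : Constructible (threeLetters P U)
  threeCon = Constructible-doubleAlong twoCon (a , false) (top , false) (cong (_∧ true) (isTop a)) _ upper

everyFin : (m : ℕ) → (Fin m → Bool) → Bool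
everyFin zero    p = true
everyFin (suc m) p = p zero ∧ everyFin m (p ∘ suc)

allB-tabulate : {A : Set} (m : ℕ) (p : A → Bool) (f : Fin m → A) →
                allB p (tabulate f) ≡ everyFin m (p ∘ f)
allB-tabulate zero    p f = refl
allB-tabulate (suc m) p f = cong (p (f zero) ∧_) (allB-tabulate m p (f ∘ suc))

everyFin-cong : (m : ℕ) {p q : Fin m → Bool} → (∀ i → p i ≡ q i) → everyFin m p ≡ everyFin m q
everyFin-cong zero    e = refl
everyFin-cong (suc m) e = cong₂ _∧_ (e zero) (everyFin-cong m (e ∘ suc))

everyFin-true : (m : ℕ) → everyFin m (λ _ → true) ≡ true
everyFin-true zero    = refl
everyFin-true (suc m) = everyFin-true m

everyFin-guard : (m : ℕ) (b : Bool) (q : Fin m → Bool) →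
                 everyFin m (λ j → not (b ∧ q j)) ≡ not b ∨ everyFin m (not ∘ q)
everyFin-guard m true  q = refl
everyFin-guard m false q = everyFin-true m

Word : ℕ → Set
Word n = Vec (Fin 3) n

leqRec : {n : ℕ} → Word n → Word n → Bool
leqRec []      []      = true
leqRec (x ∷ u) (y ∷ v) = leF x y ∧ leqRec u v

leqW≡leqRec : {n : ℕ} (u v : Word n) → leqW u v ≡ leqRec u v
leqW≡leqRec {n} u v =
  trans (allB-tabulate n (λ i → leF (lookup u i) (lookup v i)) id) (pointwise u v)
  where
  pointwise : {n : ℕ} (u v : Word n) → everyFin n (λ i → leF (lookup u i) (lookup v i)) ≡ leqRec u v
  pointwise []      []      = refl
  pointwise (x ∷ u) (y ∷ v) = cong (leF x y ∧_) (pointwise u v)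

noZero noOne : {n : ℕ} → Word n → Bool
noZero []      = true
noZero (x ∷ u) = not (x == zer) ∧ noZero u
noOne []      = true
noOne (x ∷ u) = not (x == on) ∧ noOne u

no01Rec : {n : ℕ} → Word n → Bool
no01Rec []      = true
no01Rec (x ∷ u) = (not (x == zer) ∨ noOne u) ∧ no01Rec u

noOne≡ : {n : ℕ} (u : Word n) → everyFin n (λ j → not (lookup u j == on)) ≡ noOne u
noOne≡ []      = refl
noOne≡ (x ∷ u) = cong (not (x == on) ∧_) (noOne≡ u)

no01≡no01Rec : {n : ℕ} (u : Word n) → no01 u ≡ no01Rec u
no01≡no01Rec {n} u =
  trans (allB-tabulate n (λ i → allB (pattern01 u i) (tabulate id)) id)
        (trans (everyFin-cong n (λ i → allB-tabulate n (pattern01 u i) id)) (byHead u))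
  where
  pattern01 : {n : ℕ} → Word n → Fin n → Fin n → Bool
  pattern01 u i j = not ((toℕ i <ᵇ toℕ j) ∧ (lookup u i == zer) ∧ (lookup u j == on))
  byHead : {n : ℕ} (u : Word n) → everyFin n (λ i → everyFin n (pattern01 u i)) ≡ no01Rec u
  byHead []      = refl
  byHead (x ∷ u) = cong₂ _∧_
    (trans (everyFin-guard _ (x == zer) (λ j → lookup u j == on))
           (cong (not (x == zer) ∨_) (noOne≡ u)))
    (byHead u)

isTrRec : {n : ℕ} → Word n → Bool
isTrRec u = firstNot2 u ∧ no01Rec u

isTr≡isTrRec : {n : ℕ} (u : Word n) → isTr u ≡ isTrRec u
isTr≡isTrRec u = cong (firstNot2 u ∧_) (no01≡no01Rec u)

leqRec-∷ʳ : {n : ℕ} (u v : Word n) (c d : Fin 3) → leqRec (u ∷ʳ c) (v ∷ʳ d) ≡ leqRec u v ∧ leF c d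
leqRec-∷ʳ []      []      c d = ∧-identityʳ (leF c d)
leqRec-∷ʳ (x ∷ u) (y ∷ v) c d =
  trans (cong (leF x y ∧_) (leqRec-∷ʳ u v c d)) (sym (∧-assoc (leF x y) _ _))

leqW-∷ʳ : {n : ℕ} (u v : Word n) (c d : Fin 3) → leqW (u ∷ʳ c) (v ∷ʳ d) ≡ leqW u v ∧ leF c d
leqW-∷ʳ u v c d = trans (leqW≡leqRec (u ∷ʳ c) (v ∷ʳ d))
  (trans (leqRec-∷ʳ u v c d) (cong (_∧ leF c d) (sym (leqW≡leqRec u v))))

noOne-∷ʳ : {n : ℕ} (u : Word n) (c : Fin 3) → noOne (u ∷ʳ c) ≡ noOne u ∧ not (c == on)
noOne-∷ʳ []      c = ∧-identityʳ _
noOne-∷ʳ (x ∷ u) c =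
  trans (cong (not (x == on) ∧_) (noOne-∷ʳ u c)) (sym (∧-assoc (not (x == on)) _ _))

appendable : {n : ℕ} → Fin 3 → Word n → Bool
appendable c u = not (c == on) ∨ noZero u

-- the Boolean identity behind one step of no01Rec-∷ʳ, where
-- a = (x ≠ 0), n = noOne u, r = no01Rec u, c = (last ≠ 1), z = noZero u
no01-step : (a n r c z : Bool) →
            (a ∨ (n ∧ c)) ∧ (r ∧ (c ∨ z)) ≡ ((a ∨ n) ∧ r) ∧ (c ∨ (a ∧ z))
no01-step true  _     _     _     _ = refl
no01-step false false _     _     _ = refl
no01-step false true  _     true  _ = refl
no01-step false true  true  false _ = refl
no01-step false true  false false _ = refl

no01Rec-∷ʳ : {n : ℕ} (u : Word n) (c : Fin 3) → no01Rec (u ∷ʳ c) ≡ no01Rec u ∧ appendable c u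
no01Rec-∷ʳ []      c = trans (∧-identityʳ _) (trans (∨-zeroʳ _) (sym (∨-zeroʳ _)))
no01Rec-∷ʳ (x ∷ u) c =
  trans (cong₂ (λ p q → (not (x == zer) ∨ p) ∧ q) (noOne-∷ʳ u c) (no01Rec-∷ʳ u c))
        (no01-step (not (x == zer)) (noOne u) (no01Rec u) (not (c == on)) (noZero u))

-- For a nonempty word the first letter is unaffected, so membership in
-- Tr after appending c is membership of u plus appendability of c.
isTr-∷ʳ : {n : ℕ} (u : Word (suc n)) (c : Fin 3) → isTr (u ∷ʳ c) ≡ isTr u ∧ appendable c u
isTr-∷ʳ (x ∷ u) c = begin
  isTr ((x ∷ u) ∷ʳ c)                                         ≡⟨ isTr≡isTrRec ((x ∷ u) ∷ʳ c) ⟩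
  not (x == two) ∧ no01Rec ((x ∷ u) ∷ʳ c)                     ≡⟨ cong (not (x == two) ∧_) (no01Rec-∷ʳ (x ∷ u) c) ⟩
  not (x == two) ∧ (no01Rec (x ∷ u) ∧ appendable c (x ∷ u))   ≡⟨ sym (∧-assoc (not (x == two)) _ _) ⟩
  isTrRec (x ∷ u) ∧ appendable c (x ∷ u)                      ≡⟨ cong (_∧ appendable c (x ∷ u)) (sym (isTr≡isTrRec (x ∷ u))) ⟩
  isTr (x ∷ u) ∧ appendable c (x ∷ u)                         ∎
  where open ≡-Reasoning

zeroFree : {n : ℕ} → Carrier (Tr n) → Bool
zeroFree x = noZero (proj₁ x)

-- membership proofs are irrelevant, so elements of Tr and of Ext (Tr n) U
-- are determined by their words and letters
Tr-≡ : {n : ℕ} {u v : Word n} → u ≡ v → (pu : T (isTr u)) (pv : T (isTr v)) →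
       _≡_ {A = Carrier (Tr n)} (u , pu) (v , pv)
Tr-≡ refl pu pv = cong (_ ,_) (T-irrelevant pu pv)

Ext-≡ : {n : ℕ} {u v : Word n} {c d : Fin 3} → u ≡ v → c ≡ d →
        (pu : T (isTr u)) (pv : T (isTr v)) (pc : T (appendable c u)) (pd : T (appendable d v)) →
        _≡_ {A = Carrier (Ext (Tr n) zeroFree)} ((u , pu) , c , pc) ((v , pv) , d , pd)
Ext-≡ refl refl pu pv pc pd =
  cong₂ (λ p q → ((_ , p) , _ , q)) (T-irrelevant pu pv) (T-irrelevant pc pd)

Tr-extension : (k : ℕ) → Iso (Ext (Tr (suc k)) zeroFree) (Tr (suc (suc k)))
Tr-extension k = record { bij = mk↔ₛ′ to′ from′ to∘from from∘to ; order = order }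
  where
  to′ : Carrier (Ext (Tr (suc k)) zeroFree) → Carrier (Tr (suc (suc k)))
  to′ ((u , pu) , c , pc) = u ∷ʳ c , subst T (sym (isTr-∷ʳ u c)) (Equivalence.from T-∧ (pu , pc))
  split : (v : Word (suc (suc k))) → T (isTr v) → T (isTr (init v)) × T (appendable (last v) (init v))
  split v pv = Equivalence.to T-∧
    (subst T (trans (cong isTr (proj₂ (proj₂ (initLast v)))) (isTr-∷ʳ (init v) (last v))) pv)
  from′ : Carrier (Tr (suc (suc k))) → Carrier (Ext (Tr (suc k)) zeroFree)
  from′ (v , pv) = (init v , proj₁ (split v pv)) , last v , proj₂ (split v pv)
  to∘from : ∀ z → to′ (from′ z) ≡ z
  to∘from (v , pv) = Tr-≡ (sym (proj₂ (proj₂ (initLast v)))) _ pv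
  from∘to : ∀ z → from′ (to′ z) ≡ z
  from∘to ((u , pu) , c , pc) = Ext-≡ (init-∷ʳ c u) (last-∷ʳ c u) _ _ _ _
  order : ∀ p q → le (Ext (Tr (suc k)) zeroFree) p q ≡ le (Tr (suc (suc k))) (to′ p) (to′ q)
  order ((u , _) , c , _) ((v , _) , d , _) = sym (leqW-∷ʳ u v c d)

noOne-zeros : (n : ℕ) → noOne (replicate n zer) ≡ true
noOne-zeros zero    = refl
noOne-zeros (suc n) = noOne-zeros n

no01-replicate : (c : Fin 3) (n : ℕ) → no01Rec (replicate n c) ≡ true
no01-replicate _       zero    = refl
no01-replicate zero    (suc n) = cong₂ _∧_ (noOne-zeros n) (no01-replicate zero n)
no01-replicate (suc c) (suc n) = no01-replicate (suc c) n

trWord : {n : ℕ} (u : Word n) → isTrRec u ≡ true → Carrier (Tr n)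
trWord u e = u , fromTrue (trans (isTr≡isTrRec u) e)

bottom top ones : (k : ℕ) → Carrier (Tr (suc k))
bottom k = trWord (replicate (suc k) zer) (no01-replicate zer (suc k))
top    k = trWord (on ∷ replicate k two) (no01-replicate two k)
ones   k = trWord (replicate (suc k) on) (no01-replicate on (suc k))

zeros-least : {n : ℕ} (u : Word n) → leqRec (replicate n zer) u ≡ true
zeros-least []      = refl
zeros-least (_ ∷ u) = zeros-least u

twos-greatest : {n : ℕ} (u : Word n) → leqRec u (replicate n two) ≡ true
twos-greatest []                 = refl
twos-greatest (zero ∷ u)         = twos-greatest u
twos-greatest (suc zero ∷ u)     = twos-greatest u
twos-greatest (suc (suc zero) ∷ u) = twos-greatest u

ones-below : {n : ℕ} (u : Word n) → leqRec (replicate n on) u ≡ noZero u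
ones-below []                   = refl
ones-below (zero ∷ u)           = refl
ones-below (suc zero ∷ u)       = ones-below u
ones-below (suc (suc zero) ∷ u) = ones-below u

noZero-up : {n : ℕ} (u v : Word n) → T (leqRec u v) → T (noZero u) → T (noZero v)
noZero-up []                   []                   _   _  = tt
noZero-up (suc zero ∷ u)       (suc zero ∷ v)       u≤v z = noZero-up u v u≤v z
noZero-up (suc zero ∷ u)       (suc (suc zero) ∷ v) u≤v z = noZero-up u v u≤v z
noZero-up (suc (suc zero) ∷ u) (suc (suc zero) ∷ v) u≤v z = noZero-up u v u≤v z
noZero-up (suc zero ∷ u)       (zero ∷ v)           ()  _
noZero-up (suc (suc zero) ∷ u) (zero ∷ v)           ()  _
noZero-up (suc (suc zero) ∷ u) (suc zero ∷ v)       ()  _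
noZero-up (zero ∷ u)           (_ ∷ v)              _   ()

Tr-least : (k : ℕ) (x : Carrier (Tr (suc k))) → le (Tr (suc k)) (bottom k) x ≡ true
Tr-least k (u , _) = trans (leqW≡leqRec (replicate (suc k) zer) u) (zeros-least u)

-- the top uses that the first letter of a word in Tr is not 2
Tr-greatest : (k : ℕ) (x : Carrier (Tr (suc k))) → le (Tr (suc k)) x (top k) ≡ true
Tr-greatest k ((x ∷ u) , p) = trans (leqW≡leqRec (x ∷ u) (on ∷ replicate k two)) (cong₂ _∧_ (firstBelow1 x p) (twos-greatest u))
  where
  firstBelow1 : (x : Fin 3) → T (isTr (x ∷ u)) → leF x on ≡ true
  firstBelow1 zero             _ = refl
  firstBelow1 (suc zero)       _ = refl
  firstBelow1 (suc (suc zero)) p with () ← subst T (isTr≡isTrRec (two ∷ u)) p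

Tr-ones : (k : ℕ) (x : Carrier (Tr (suc k))) → zeroFree x ≡ le (Tr (suc k)) (ones k) x
Tr-ones k (u , _) = sym (trans (leqW≡leqRec (replicate (suc k) on) u) (ones-below u))

Tr-zeroFree-up : (n : ℕ) → UpClosed (Tr n) zeroFree
Tr-zeroFree-up n (u , _) (v , _) u≤v = noZero-up u v (subst T (leqW≡leqRec u v) u≤v)

Tr1-Iso : Iso (double one tt tt) (Tr 1)
Tr1-Iso = record { bij = mk↔ₛ′ to′ from′ to∘from from∘to ; order = order }
  where
  to′ : Carrier (double one tt tt) → Carrier (Tr 1)
  to′ (tt , false) = zer ∷ [] , tt
  to′ (tt , true)  = on ∷ [] , tt
  from′ : Carrier (Tr 1) → Carrier (double one tt tt)
  from′ ((zero ∷ []) , _)             = tt , false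
  from′ ((suc zero ∷ []) , _)         = tt , true
  from′ ((suc (suc zero) ∷ []) , ())
  to∘from : ∀ z → to′ (from′ z) ≡ z
  to∘from ((zero ∷ []) , _)           = refl
  to∘from ((suc zero ∷ []) , _)       = refl
  to∘from ((suc (suc zero) ∷ []) , ())
  from∘to : ∀ z → from′ (to′ z) ≡ z
  from∘to (tt , false) = refl
  from∘to (tt , true)  = refl
  order : ∀ p q → le (double one tt tt) p q ≡ le (Tr 1) (to′ p) (to′ q)
  order (tt , false) (tt , false) = refl
  order (tt , false) (tt , true)  = refl
  order (tt , true)  (tt , false) = refl
  order (tt , true)  (tt , true)  = refl

Tr-constructible : (k : ℕ) → Constructible (Tr (suc k))
Tr-constructible zero    = double one tt tt , step one base tt tt tt , Tr1-Iso
Tr-constructible (suc k) = Constructible-Iso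
  (Constructible-Ext zeroFree (bottom k) (top k) (ones k)
     (Tr-least k) (Tr-greatest k) (Tr-ones k) (Tr-zeroFree-up (suc k)) (Tr-constructible k))
  (Tr-extension k)

theorem2p3 : (n : ℕ) → 1 ≤ n → Constructible (Tr n)
theorem2p3 (suc k) _ = Tr-constructible k
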